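{- Let $M$ be a standard multigraph, let $v_1,v_2,v_3$ be vertices spanning a $5$-triangle $T$ (pairwise adjacent with total multiplicity $\mu(v_1,v_2)+\mu(v_2,v_3)+\mu(v_1,v_3)=5$), and let $x_1,x_2$ be distinct vertices not in $\{v_1,v_2,v_3\}$ with $\|x_1,T\|+\|x_2,T\|\ge 9$, where $\|x,T\|=\sum_{i=1}^3\mu(x,v_i)$. Then the five vertices $\{x_1,x_2,v_1,v_2,v_3\}$ can be partitioned into a set $S$ of three vertices and a pair $\{u,w\}$ such that $S$ is pairwise adjacent with total multiplicity at least $5$ (so $S$ spans a $5$-triangle), $\mu(u,w)\ge1$, and moreover $\mu(u,w)=2$ (the edge is heavy) if $\min\{\|x_1,T\|,\|x_2,T\|\}\ge4$.
   Context: Multigraphs have no loops; $\mu(x,y)$ is the number of edges with ends $x,y$; $M$ is standard if $\mu(x,y)\le2$ for all $x,y$. An edge $xy$ is heavy if $\mu(x,y)=2$. A $5$-triangle is a multigraph on three vertices containing a triangle $C_3$ and having $5$ edges counted with multiplicity. -}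

module Defs where

open import Data.Nat using (ℕ; zero; suc; _+_; _≤_; _≥_; _⊓_)
open import Data.Fin using (Fin)
open import Data.Product using (_×_; Σ; _,_)
open import Relation.Binary.PropositionalEquality using (_≡_)
open import Function.Bundles using (_↔_)
open import Data.Vec using (Vec; _∷_; []; lookup)

record Multigraph (n : ℕ) : Set where
  field
    μ        : Fin n → Fin n → ℕ
    μ-sym    : ∀ x y → μ x y ≡ μ y x
    loopless : ∀ x → μ x x ≡ 0

open Multigraph public

Standard : ∀ {n} → Multigraph n → Set
Standard M = ∀ x y → μ M x y ≤ 2

Adjacent : ∀ {n} → Multigraph n → Fin n → Fin n → Set
Adjacent M x y = 1 ≤ μ M x y

triMult : ∀ {n} → Multigraph n → Fin n → Fin n → Fin n → ℕ
triMult M a b c = μ M a b + μ M b c + μ M a c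

PairwiseAdjacent : ∀ {n} → Multigraph n → Fin n → Fin n → Fin n → Set
PairwiseAdjacent M a b c = Adjacent M a b × Adjacent M b c × Adjacent M a c

degT : ∀ {n} → Multigraph n → Fin n → Fin n → Fin n → Fin n → ℕ
degT M x v₁ v₂ v₃ = μ M x v₁ + μ M x v₂ + μ M x v₃

module Submission where

-- Every candidate re-split puts one xᵢ into a triangle with two of the vᵢ and
-- pairs the other x with the remaining v; there are six of them.  Whether a
-- candidate works depends only on nine multiplicities: the three edges of T and
-- the three edges from each xᵢ to T (a `Profile`).  The proof therefore has two
-- halves.
--   * Arithmetic: in a standard multigraph each multiplicity lies in {0,1,2}, so
--     the claim "the hypotheses on a profile force some candidate to work" is a
--     decidable statement about a vector in {0,1,2}⁹; it is verified by
--     exhaustive evaluation (`every≤2`, justified by `every≤2-sound`).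
--   * Geometry: each candidate is realised by an explicit arrangement σ of
--     (x₁, x₂, v₁, v₂, v₃) built from transpositions, and for the profile read
--     off M the arithmetic condition is literally the conclusion for that σ.
-- The distinctness hypotheses only make the five vertices a genuine partition;
-- the adjacency inside T is implied by μ ≤ 2 and total multiplicity 5.

open import Defs
open import Data.Nat using (ℕ; zero; suc; _+_; _≤_; _≥_; _⊓_; _≤?_; _≟_; s≤s)
open import Data.Fin using (Fin)
open import Data.Fin.Patterns using (0F; 1F; 2F; 3F; 4F)
open import Data.Fin.Permutation using (Permutation′; transpose; _∘ₚ_)
open import Data.Fin.Properties using (any?)
open import Data.Bool using (Bool; T; _∧_)
open import Data.Bool.Properties using (T-∧)
open import Data.Product using (_×_; Σ; ∃₂; _,_; proj₁; proj₂)
open import Data.Vec using (Vec; _∷_; []; lookup)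
open import Data.Vec.Relation.Unary.All using (All; _∷_; [])
open import Relation.Binary.PropositionalEquality using (_≡_; _≢_)
open import Relation.Nullary.Decidable using (Dec; isYes; toWitness; _×-dec_; _→-dec_)
open import Function.Bundles using (_↔_; Equivalence)

every≤2 : ∀ k → (Vec ℕ k → Bool) → Bool
every≤2 zero    P = P []
every≤2 (suc k) P =
  every≤2 k (λ v → P (0 ∷ v)) ∧ every≤2 k (λ v → P (1 ∷ v)) ∧ every≤2 k (λ v → P (2 ∷ v))

T-∧₃ : ∀ {x y z} → T (x ∧ y ∧ z) → T x × T y × T z
T-∧₃ {x} ok with Equivalence.to (T-∧ {x}) ok
... | okˣ , okʸᶻ = okˣ , Equivalence.to T-∧ okʸᶻ

every≤2-sound : ∀ {k} (P : Vec ℕ k → Bool) {v : Vec ℕ k} →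
  All (_≤ 2) v → T (every≤2 k P) → T (P v)
every≤2-sound P [] ok = ok
every≤2-sound {suc k} P {x ∷ _} (x≤2 ∷ bounded) ok =
  every≤2-sound (λ v → P (x ∷ v)) bounded (branch x x≤2)
  where
  branches : T (every≤2 k (λ v → P (0 ∷ v))) × T (every≤2 k (λ v → P (1 ∷ v))) ×
             T (every≤2 k (λ v → P (2 ∷ v)))
  branches = T-∧₃ {every≤2 k (λ v → P (0 ∷ v))} {every≤2 k (λ v → P (1 ∷ v))} ok

  branch : ∀ y → y ≤ 2 → T (every≤2 k (λ v → P (y ∷ v)))
  branch 0 _ = proj₁ branches
  branch 1 _ = proj₁ (proj₂ branches)
  branch 2 _ = proj₂ (proj₂ branches)
  branch (suc (suc (suc _))) (s≤s (s≤s ()))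

-- The nine multiplicities the statement depends on: the edges of T and the
-- edges from x₁ (the pᵢ) and from x₂ (the qᵢ) to vᵢ.
record Profile : Set where
  constructor profile
  field
    t₁₂ t₂₃ t₁₃ p₁ p₂ p₃ q₁ q₂ q₃ : ℕ

open Profile

fromVec : Vec ℕ 9 → Profile
fromVec (a ∷ b ∷ c ∷ d ∷ e ∷ f ∷ g ∷ h ∷ i ∷ []) = profile a b c d e f g h i

Hyp : Profile → Set
Hyp π = t₁₂ π + t₂₃ π + t₁₃ π ≡ 5 × 9 ≤ (p₁ π + p₂ π + p₃ π) + (q₁ π + q₂ π + q₃ π)

Heavy : Profile → Set
Heavy π = 4 ≤ (p₁ π + p₂ π + p₃ π) ⊓ (q₁ π + q₂ π + q₃ π)

record Split : Set where
  constructor split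
  field
    ab bc ac uw : ℕ

SplitOk : Set → Split → Set
SplitOk H (split ab bc ac uw) =
  (1 ≤ ab × 1 ≤ bc × 1 ≤ ac) × 5 ≤ ab + bc + ac × 1 ≤ uw × (H → uw ≡ 2)

splitOk? : ∀ {H} → Dec H → ∀ s → Dec (SplitOk H s)
splitOk? H? (split ab bc ac uw) =
  (1 ≤? ab ×-dec 1 ≤? bc ×-dec 1 ≤? ac) ×-dec 5 ≤? ab + bc + ac ×-dec
  1 ≤? uw ×-dec (H? →-dec uw ≟ 2)

-- Candidate (i , l): x_{i+1} forms a triangle with the two v's other than
-- v_{l+1}, and the other x is paired with v_{l+1}.
candidate : Fin 2 → Fin 3 → Profile → Split
candidate 0F 0F π = split (p₂ π) (t₂₃ π) (p₃ π) (q₁ π)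
candidate 0F 1F π = split (p₁ π) (t₁₃ π) (p₃ π) (q₂ π)
candidate 0F 2F π = split (p₁ π) (t₁₂ π) (p₂ π) (q₃ π)
candidate 1F 0F π = split (q₂ π) (t₂₃ π) (q₃ π) (p₁ π)
candidate 1F 1F π = split (q₁ π) (t₁₃ π) (q₃ π) (p₂ π)
candidate 1F 2F π = split (q₁ π) (t₁₂ π) (q₂ π) (p₃ π)

Good : Fin 2 → Fin 3 → Profile → Set
Good i l π = SplitOk (Heavy π) (candidate i l π)

Claim : Profile → Set
Claim π = Hyp π → ∃₂ λ i l → Good i l π

claim? : ∀ π → Dec (Claim π)
claim? π = (_ ≟ 5 ×-dec 9 ≤? _) →-dec
  any? (λ i → any? (λ l → splitOk? (4 ≤? _) (candidate i l π)))

claim-everywhere : T (every≤2 9 (λ v → isYes (claim? (fromVec v))))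
claim-everywhere = _

claim : ∀ v → All (_≤ 2) v → Claim (fromVec v)
claim v bounded = toWitness {a? = claim? (fromVec v)}
  (every≤2-sound (λ w → isYes (claim? (fromVec w))) bounded claim-everywhere)

-- Arrangements of P = (x₁, x₂, v₁, v₂, v₃): slots 0,1,2 hold the triangle
-- (x, vⱼ, vₖ) with j < k and slots 3,4 hold the pair (x′, v_l), as in `Good`.
-- The basic one is (x₁, v₁, v₂ | x₂, v₃); the others exchange vertices of P.
basicArrangement : Permutation′ 5
basicArrangement = transpose 2F 3F ∘ₚ transpose 1F 2F

x₁-arrangement : Fin 3 → Permutation′ 5
-- (x₁, v₂, v₃ | x₂, v₁): exchange v₂ with v₃, then v₁ with v₂
x₁-arrangement 0F = basicArrangement ∘ₚ transpose 3F 4F ∘ₚ transpose 2F 3F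
-- (x₁, v₁, v₃ | x₂, v₂): exchange v₂ with v₃
x₁-arrangement 1F = basicArrangement ∘ₚ transpose 3F 4F
x₁-arrangement 2F = basicArrangement

arrangement : Fin 2 → Fin 3 → Permutation′ 5
arrangement 0F l = x₁-arrangement l
arrangement 1F l = x₁-arrangement l ∘ₚ transpose 0F 1F

SplitsWell : ∀ {n} → Multigraph n → (v₁ v₂ v₃ x₁ x₂ : Fin n) → Fin 5 ↔ Fin 5 → Set
SplitsWell M v₁ v₂ v₃ x₁ x₂ σ =
  let P = x₁ ∷ x₂ ∷ v₁ ∷ v₂ ∷ v₃ ∷ []
      f = Function.Bundles.Inverse.to σ
      a = lookup P (f Fin.zero)
      b = lookup P (f (Fin.suc Fin.zero))
      c = lookup P (f (Fin.suc (Fin.suc Fin.zero)))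
      u = lookup P (f (Fin.suc (Fin.suc (Fin.suc Fin.zero))))
      w = lookup P (f (Fin.suc (Fin.suc (Fin.suc (Fin.suc Fin.zero)))))
  in PairwiseAdjacent M a b c × triMult M a b c ≥ 5 × Adjacent M u w ×
     (degT M x₁ v₁ v₂ v₃ ⊓ degT M x₂ v₁ v₂ v₃ ≥ 4 → μ M u w ≡ 2)

module _ {n} (M : Multigraph n) (v₁ v₂ v₃ x₁ x₂ : Fin n) where

  localMults : Vec ℕ 9
  localMults = μ M v₁ v₂ ∷ μ M v₂ v₃ ∷ μ M v₁ v₃ ∷
               μ M x₁ v₁ ∷ μ M x₁ v₂ ∷ μ M x₁ v₃ ∷
               μ M x₂ v₁ ∷ μ M x₂ v₂ ∷ μ M x₂ v₃ ∷ []

  localMults-bounded : Standard M → All (_≤ 2) localMults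
  localMults-bounded standard =
    standard _ _ ∷ standard _ _ ∷ standard _ _ ∷ standard _ _ ∷ standard _ _ ∷
    standard _ _ ∷ standard _ _ ∷ standard _ _ ∷ standard _ _ ∷ []

  realise : ∀ i l → Good i l (fromVec localMults) →
            SplitsWell M v₁ v₂ v₃ x₁ x₂ (arrangement i l)
  realise 0F 0F good = good
  realise 0F 1F good = good
  realise 0F 2F good = good
  realise 1F 0F good = good
  realise 1F 1F good = good
  realise 1F 2F good = good

proposition14 : ∀ {n} (M : Multigraph n) → Standard M →
  (v₁ v₂ v₃ x₁ x₂ : Fin n) →
  PairwiseAdjacent M v₁ v₂ v₃ → triMult M v₁ v₂ v₃ ≡ 5 →
  x₁ ≢ x₂ → x₁ ≢ v₁ → x₁ ≢ v₂ → x₁ ≢ v₃ → x₂ ≢ v₁ → x₂ ≢ v₂ → x₂ ≢ v₃ →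
  degT M x₁ v₁ v₂ v₃ + degT M x₂ v₁ v₂ v₃ ≥ 9 →
  Σ (Fin 5 ↔ Fin 5) λ σ →
    let P = x₁ ∷ x₂ ∷ v₁ ∷ v₂ ∷ v₃ ∷ []
        f = Function.Bundles.Inverse.to σ
        a = lookup P (f Fin.zero)
        b = lookup P (f (Fin.suc Fin.zero))
        c = lookup P (f (Fin.suc (Fin.suc Fin.zero)))
        u = lookup P (f (Fin.suc (Fin.suc (Fin.suc Fin.zero))))
        w = lookup P (f (Fin.suc (Fin.suc (Fin.suc (Fin.suc Fin.zero)))))
    in PairwiseAdjacent M a b c × triMult M a b c ≥ 5 × Adjacent M u w ×
       (degT M x₁ v₁ v₂ v₃ ⊓ degT M x₂ v₁ v₂ v₃ ≥ 4 → μ M u w ≡ 2)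
proposition14 M standard v₁ v₂ v₃ x₁ x₂ _ total _ _ _ _ _ _ _ degrees
  with claim (localMults M v₁ v₂ v₃ x₁ x₂) (localMults-bounded M v₁ v₂ v₃ x₁ x₂ standard)
             (total , degrees)
... | i , l , good = arrangement i l , realise M v₁ v₂ v₃ x₁ x₂ i l good
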